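{- For every variable $x$, term $t$ and formulas $\alpha,\beta,\gamma$: if $\alpha[x/t]\equiv\beta$ and $\alpha[x/t]\equiv\gamma$, then $\beta=\gamma$.
   Context: Terms and formulas are first-order over variables $x_0,x_1,\dots$, function symbols and relation symbols with arities; formulas are atoms $R(t_1,\dots,t_k)$, $\alpha\Rightarrow\beta$, $\alpha\wedge\beta$, $\alpha\vee\beta$, $\forall y\,\alpha$, $\exists y\,\alpha$. Term substitution $us[x/t]\equiv vs$ on vectors of terms is the inductive relation: $x\mapsto t$, a variable $y\neq x$ is unchanged, $f(us)\mapsto f(vs)$ when $us[x/t]\equiv vs$, applied componentwise to vectors. "$x$ not free in $\alpha$" is the usual inductive relation ($x$ occurs in no term of an atom; componentwise for connectives; always for $\forall x\,\alpha,\exists x\,\alpha$; for $\forall y\,\alpha,\exists y\,\alpha$ when $x$ is not free in $\alpha$). The relation $\alpha[x/t]\equiv\beta$ is defined inductively by the rules: (ident) $\alpha[x/x]\equiv\alpha$ for every $\alpha$ and $x$ (here $x$ as a term); (notfree) if $x$ is not free in $\alpha$ then $\alpha[x/t]\equiv\alpha$; (atom) if $us[x/t]\equiv vs$ then $R(us)[x/t]\equiv R(vs)$; (connectives) if $\alpha[x/t]\equiv\alpha'$ and $\beta[x/t]\equiv\beta'$ then $(\alpha\circ\beta)[x/t]\equiv(\alpha'\circ\beta')$ for $\circ\in\{\Rightarrow,\wedge,\vee\}$; $(\forall x\,\alpha)[x/t]\equiv\forall x\,\alpha$ and $(\exists x\,\alpha)[x/t]\equiv\exists x\,\alpha$; if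 $x\neq y$, $y$ does not occur in $t$, and $\alpha[x/t]\equiv\beta$, then $(\forall y\,\alpha)[x/t]\equiv\forall y\,\beta$ and $(\exists y\,\alpha)[x/t]\equiv\exists y\,\beta$. -}

module Defs where

open import Data.Nat using (ℕ)
open import Data.Vec using (Vec; []; _∷_)
open import Relation.Binary.PropositionalEquality using (_≡_)
open import Relation.Nullary using (¬_)

record Signature : Set₁ where
  field
    FunSym : Set
    funArity : FunSym → ℕ
    RelSym : Set
    relArity : RelSym → ℕ
open Signature

Var : Set
Var = ℕ

module Syntax (Σ : Signature) where

  data Term : Set where
    var : Var → Term
    fun : (f : FunSym Σ) → Vec Term (funArity Σ f) → Term

  data Formula : Set where
    rel : (R : RelSym Σ) → Vec Term (relArity Σ R) → Formula
    _⇒_ : Formula → Formula → Formula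
    _∧_ : Formula → Formula → Formula
    _∨_ : Formula → Formula → Formula
    all : Var → Formula → Formula
    ex  : Var → Formula → Formula

  mutual
    data TmSubst (x : Var) (s : Term) : Term → Term → Set where
      var-eq  : TmSubst x s (var x) s
      var-neq : ∀ {y} → ¬ (y ≡ x) → TmSubst x s (var y) (var y)
      fun-sub : ∀ {f us vs} → VecSubst x s us vs → TmSubst x s (fun f us) (fun f vs)

    data VecSubst (x : Var) (s : Term) : ∀ {n} → Vec Term n → Vec Term n → Set where
      []  : VecSubst x s [] []
      _∷_ : ∀ {n u v} {us vs : Vec Term n} →
            TmSubst x s u v → VecSubst x s us vs → VecSubst x s (u ∷ us) (v ∷ vs)

  mutual
    data OccursTm (x : Var) : Term → Set where
      here : OccursTm x (var x)
      infun : ∀ {f us} → OccursVec x us → OccursTm x (fun f us)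

    data OccursVec (x : Var) : ∀ {n} → Vec Term n → Set where
      hd : ∀ {n u} {us : Vec Term n} → OccursTm x u → OccursVec x (u ∷ us)
      tl : ∀ {n u} {us : Vec Term n} → OccursVec x us → OccursVec x (u ∷ us)

  data NotFree (x : Var) : Formula → Set where
    nf-rel : ∀ {R us} → ¬ OccursVec x us → NotFree x (rel R us)
    nf-⇒   : ∀ {α β} → NotFree x α → NotFree x β → NotFree x (α ⇒ β)
    nf-∧   : ∀ {α β} → NotFree x α → NotFree x β → NotFree x (α ∧ β)
    nf-∨   : ∀ {α β} → NotFree x α → NotFree x β → NotFree x (α ∨ β)
    nf-all-same : ∀ {α} → NotFree x (all x α)
    nf-ex-same  : ∀ {α} → NotFree x (ex x α)
    nf-all : ∀ {y α} → NotFree x α → NotFree x (all y α)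
    nf-ex  : ∀ {y α} → NotFree x α → NotFree x (ex y α)

  data Subst (x : Var) : Term → Formula → Formula → Set where
    ident   : ∀ {α} → Subst x (var x) α α
    notfree : ∀ {t α} → NotFree x α → Subst x t α α
    atom    : ∀ {t R us vs} → VecSubst x t us vs → Subst x t (rel R us) (rel R vs)
    s-⇒     : ∀ {t α α' β β'} → Subst x t α α' → Subst x t β β' → Subst x t (α ⇒ β) (α' ⇒ β')
    s-∧     : ∀ {t α α' β β'} → Subst x t α α' → Subst x t β β' → Subst x t (α ∧ β) (α' ∧ β')
    s-∨     : ∀ {t α α' β β'} → Subst x t α α' → Subst x t β β' → Subst x t (α ∨ β) (α' ∨ β')
    all-same : ∀ {t α} → Subst x t (all x α) (all x α)
    ex-same  : ∀ {t α} → Subst x t (ex x α) (ex x α)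
    s-all   : ∀ {t y α β} → ¬ (x ≡ y) → ¬ OccursTm y t → Subst x t α β → Subst x t (all y α) (all y β)
    s-ex    : ∀ {t y α β} → ¬ (x ≡ y) → ¬ OccursTm y t → Subst x t α β → Subst x t (ex y α) (ex y β)

-- Substitution is defined by a non-syntax-directed system: besides the structural
-- rules, (ident) and (notfree) apply to every formula of the right kind. Both of
-- these leave the formula unchanged, and every derivation of α[x/t] ≡ β whose
-- premises make (ident) or (notfree) applicable also yields β = α. So whenever two
-- derivations start with different rules, one of them is an identity and the other
-- is forced to be one too; otherwise they agree by induction.
module Submission where

open import Data.Empty using (⊥-elim)
open import Data.Vec using (Vec; []; _∷_)
open import Relation.Binary.Rewriting using (Deterministic)
open import Relation.Binary.PropositionalEquality using (_≡_; refl; sym; cong; cong₂)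
open import Relation.Nullary using (¬_)

open import Defs

module _ {Σ : Signature} where
  open Syntax Σ

  mutual
    TmSubst-deterministic : ∀ {x s} → Deterministic _≡_ (TmSubst x s)
    TmSubst-deterministic var-eq      var-eq      = refl
    TmSubst-deterministic var-eq      (var-neq x≢x) = ⊥-elim (x≢x refl)
    TmSubst-deterministic (var-neq x≢x) var-eq    = ⊥-elim (x≢x refl)
    TmSubst-deterministic (var-neq _) (var-neq _) = refl
    TmSubst-deterministic (fun-sub p) (fun-sub q) = cong (fun _) (VecSubst-deterministic p q)

    VecSubst-deterministic : ∀ {x s n} → Deterministic _≡_ (VecSubst x s {n})
    VecSubst-deterministic []       []       = refl
    VecSubst-deterministic (p ∷ ps) (q ∷ qs) =
      cong₂ _∷_ (TmSubst-deterministic p q) (VecSubst-deterministic ps qs)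

  mutual
    TmSubst-notOccurs⇒≡ : ∀ {x s u v} → TmSubst x s u v → ¬ OccursTm x u → v ≡ u
    TmSubst-notOccurs⇒≡ var-eq      x∉u = ⊥-elim (x∉u here)
    TmSubst-notOccurs⇒≡ (var-neq _) _   = refl
    TmSubst-notOccurs⇒≡ (fun-sub p) x∉u = cong (fun _) (VecSubst-notOccurs⇒≡ p (λ o → x∉u (infun o)))

    VecSubst-notOccurs⇒≡ : ∀ {x s n} {us vs : Vec Term n} →
                           VecSubst x s us vs → ¬ OccursVec x us → vs ≡ us
    VecSubst-notOccurs⇒≡ []       _   = refl
    VecSubst-notOccurs⇒≡ (p ∷ ps) x∉us =
      cong₂ _∷_ (TmSubst-notOccurs⇒≡ p (λ o → x∉us (hd o)))
                (VecSubst-notOccurs⇒≡ ps (λ o → x∉us (tl o)))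

  mutual
    TmSubst-ident⇒≡ : ∀ {x u v} → TmSubst x (var x) u v → v ≡ u
    TmSubst-ident⇒≡ var-eq      = refl
    TmSubst-ident⇒≡ (var-neq _) = refl
    TmSubst-ident⇒≡ (fun-sub p) = cong (fun _) (VecSubst-ident⇒≡ p)

    VecSubst-ident⇒≡ : ∀ {x n} {us vs : Vec Term n} → VecSubst x (var x) us vs → vs ≡ us
    VecSubst-ident⇒≡ []       = refl
    VecSubst-ident⇒≡ (p ∷ ps) = cong₂ _∷_ (TmSubst-ident⇒≡ p) (VecSubst-ident⇒≡ ps)

  Subst-notFree⇒≡ : ∀ {x t α β} → Subst x t α β → NotFree x α → β ≡ α
  Subst-notFree⇒≡ ident         _              = refl
  Subst-notFree⇒≡ (notfree _)   _              = refl
  Subst-notFree⇒≡ (atom p)      (nf-rel x∉us)  = cong (rel _) (VecSubst-notOccurs⇒≡ p x∉us)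
  Subst-notFree⇒≡ (s-⇒ p q)     (nf-⇒ a b)     = cong₂ _⇒_ (Subst-notFree⇒≡ p a) (Subst-notFree⇒≡ q b)
  Subst-notFree⇒≡ (s-∧ p q)     (nf-∧ a b)     = cong₂ _∧_ (Subst-notFree⇒≡ p a) (Subst-notFree⇒≡ q b)
  Subst-notFree⇒≡ (s-∨ p q)     (nf-∨ a b)     = cong₂ _∨_ (Subst-notFree⇒≡ p a) (Subst-notFree⇒≡ q b)
  Subst-notFree⇒≡ all-same      _              = refl
  Subst-notFree⇒≡ ex-same       _              = refl
  Subst-notFree⇒≡ (s-all x≢x _ _) nf-all-same  = ⊥-elim (x≢x refl)
  Subst-notFree⇒≡ (s-all _ _ p) (nf-all a)     = cong (all _) (Subst-notFree⇒≡ p a)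
  Subst-notFree⇒≡ (s-ex x≢x _ _) nf-ex-same    = ⊥-elim (x≢x refl)
  Subst-notFree⇒≡ (s-ex _ _ p)  (nf-ex a)      = cong (ex _) (Subst-notFree⇒≡ p a)

  Subst-ident⇒≡ : ∀ {x α β} → Subst x (var x) α β → β ≡ α
  Subst-ident⇒≡ ident         = refl
  Subst-ident⇒≡ (notfree _)   = refl
  Subst-ident⇒≡ (atom p)      = cong (rel _) (VecSubst-ident⇒≡ p)
  Subst-ident⇒≡ (s-⇒ p q)     = cong₂ _⇒_ (Subst-ident⇒≡ p) (Subst-ident⇒≡ q)
  Subst-ident⇒≡ (s-∧ p q)     = cong₂ _∧_ (Subst-ident⇒≡ p) (Subst-ident⇒≡ q)
  Subst-ident⇒≡ (s-∨ p q)     = cong₂ _∨_ (Subst-ident⇒≡ p) (Subst-ident⇒≡ q)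
  Subst-ident⇒≡ all-same      = refl
  Subst-ident⇒≡ ex-same       = refl
  Subst-ident⇒≡ (s-all _ _ p) = cong (all _) (Subst-ident⇒≡ p)
  Subst-ident⇒≡ (s-ex _ _ p)  = cong (ex _) (Subst-ident⇒≡ p)

  Subst-deterministic : ∀ {x t} → Deterministic _≡_ (Subst x t)
  Subst-deterministic ident       q           = sym (Subst-ident⇒≡ q)
  Subst-deterministic p           ident       = Subst-ident⇒≡ p
  Subst-deterministic (notfree a) q           = sym (Subst-notFree⇒≡ q a)
  Subst-deterministic p           (notfree a) = Subst-notFree⇒≡ p a
  Subst-deterministic (atom p)    (atom q)    = cong (rel _) (VecSubst-deterministic p q)
  Subst-deterministic (s-⇒ p q)   (s-⇒ p' q') = cong₂ _⇒_ (Subst-deterministic p p') (Subst-deterministic q q')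
  Subst-deterministic (s-∧ p q)   (s-∧ p' q') = cong₂ _∧_ (Subst-deterministic p p') (Subst-deterministic q q')
  Subst-deterministic (s-∨ p q)   (s-∨ p' q') = cong₂ _∨_ (Subst-deterministic p p') (Subst-deterministic q q')
  Subst-deterministic all-same    all-same    = refl
  Subst-deterministic all-same    (s-all x≢x _ _) = ⊥-elim (x≢x refl)
  Subst-deterministic (s-all x≢x _ _) all-same    = ⊥-elim (x≢x refl)
  Subst-deterministic (s-all _ _ p) (s-all _ _ q) = cong (all _) (Subst-deterministic p q)
  Subst-deterministic ex-same     ex-same     = refl
  Subst-deterministic ex-same     (s-ex x≢x _ _) = ⊥-elim (x≢x refl)
  Subst-deterministic (s-ex x≢x _ _) ex-same     = ⊥-elim (x≢x refl)
  Subst-deterministic (s-ex _ _ p) (s-ex _ _ q) = cong (ex _) (Subst-deterministic p q)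

proposition6p3p2 : (Σ : Signature) → let open Syntax Σ in
    (x : Var) (t : Term) (α β γ : Formula) →
    Subst x t α β → Subst x t α γ → β ≡ γ
proposition6p3p2 Σ x t α β γ = Subst-deterministic
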